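{- $WO^1$ is HPL-independent of $choice_h$; that is, there is a Henkin–Asser structure which is a model of $choice_h\cup\{WO^1\}$ and there is a Henkin–Asser structure which is a model of $choice_h\cup\{\neg WO^1\}$, so that neither $WO^1$ nor $\neg WO^1$ follows from ${}^hax^{(2)}\cup choice_h$ in HPL.
   Context: The metatheory is ZFC, assumed consistent. Second-order predicate logic with Henkin semantics (HPL): for a nonempty set $I$, ${\rm pred}_k(I)$ is the set of maps $I^k\to\{true,false\}$; a predicate structure is $(J_k)_{k\ge0}$ with $J_0=I$ and $\emptyset\ne J_k\subseteq{\rm pred}_k(I)$, $k$-ary predicate quantifiers ranging over $J_k$. A structure is a model of a set of formulas if each is true under every assignment. ${}^hax^{(2)}$ is the set of comprehension axioms $\exists A\forall\mathbf x(A\mathbf x\leftrightarrow G)$ ($G$ any formula with $A$ not free, $\mathbf x$ a tuple of distinct individual variables); Henkin–Asser structures are the predicate structures that are models of ${}^hax^{(2)}$, and a formula follows in HPL from a set $\Phi$ if it is true in every Henkin–Asser structure that is a model of $\Phi$. $choice_h=\bigcup_{n,m\ge1}choice_h^{n,m}$, where $choice_h^{n,m}$ is the set of all formulas $\forall\mathbf x\exists D\,H(\mathbf x,D)\to\exists S\forall\mathbf x\exists D\big(\forall\mathbf y(D\mathbf y\leftrightarrow S\mathbf x\mathbf y)\land H(\mathbf x,D)\big)$, with $H$ any second-order formula, $\mathbf x$ an $n$-tuple and $\mathbf y$ an $m$-tuple of distinct individual variables, $D$ an $m$-ary and $S$ an $(n+m)$-ary predicate variable, $\mathbf y$ and $S$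 not occurring in $H$. $WO^1=\forall A\exists T\,wo(T,A)$ ($A$ unary, $T$ binary), where $wo(T,A)$ states that $T$ is a reflexive, antisymmetric, transitive relation on $A$, total on $A$, and every nonempty $B$ with $\forall x(Bx\to Ax)$ has an element $x_0$ with $\forall x_1(Bx_1\to Tx_0x_1)$. -}

module Defs where

open import Data.Nat using (ℕ; zero; suc; _+_; _≟_; _≡ᵇ_)
open import Data.Bool using (Bool; true; false; _∨_; _∧_; not; if_then_else_; T)
open import Data.Fin using (Fin)
open import Data.Vec using (Vec; []; _∷_; _++_; lookup; map)
open import Data.Product using (Σ; _×_; _,_; proj₁)
open import Data.Sum using (_⊎_)
open import Data.Empty using (⊥)
open import Relation.Nullary using (¬_; yes; no)
open import Relation.Binary.PropositionalEquality using (_≡_; refl)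
open import Function.Bundles using (_⇔_)

-- Predicate variables are named by a pair (k , p): k encodes the arity
-- (the arity is  suc k ≥ 1), p is the name.

data Formula : Set where
  eq   : ℕ → ℕ → Formula
  pv   : (k p : ℕ) → Vec ℕ (suc k) → Formula
  neg  : Formula → Formula
  and  : Formula → Formula → Formula
  or   : Formula → Formula → Formula
  imp  : Formula → Formula → Formula
  iff  : Formula → Formula → Formula
  all  : ℕ → Formula → Formula
  ex   : ℕ → Formula → Formula
  allP : (k p : ℕ) → Formula → Formula
  exP  : (k p : ℕ) → Formula → Formula

allV : ∀ {n} → Vec ℕ n → Formula → Formula
allV []       φ = φ
allV (x ∷ xs) φ = all x (allV xs φ)

memV : ∀ {n} → ℕ → Vec ℕ n → Bool
memV x []       = false
memV x (y ∷ ys) = (x ≡ᵇ y) ∨ memV x ys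

occInd : ℕ → Formula → Bool
occInd x (eq y z)       = (x ≡ᵇ y) ∨ (x ≡ᵇ z)
occInd x (pv k p ys)    = memV x ys
occInd x (neg φ)        = occInd x φ
occInd x (and φ ψ)      = occInd x φ ∨ occInd x ψ
occInd x (or φ ψ)       = occInd x φ ∨ occInd x ψ
occInd x (imp φ ψ)      = occInd x φ ∨ occInd x ψ
occInd x (iff φ ψ)      = occInd x φ ∨ occInd x ψ
occInd x (all y φ)      = (x ≡ᵇ y) ∨ occInd x φ
occInd x (ex y φ)       = (x ≡ᵇ y) ∨ occInd x φ
occInd x (allP k p φ)   = occInd x φ
occInd x (exP k p φ)    = occInd x φ

sameP : (k p k' p' : ℕ) → Bool
sameP k p k' p' = (k ≡ᵇ k') ∧ (p ≡ᵇ p')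

occPred : (k p : ℕ) → Formula → Bool
occPred k p (eq y z)       = false
occPred k p (pv k' p' ys)  = sameP k p k' p'
occPred k p (neg φ)        = occPred k p φ
occPred k p (and φ ψ)      = occPred k p φ ∨ occPred k p ψ
occPred k p (or φ ψ)       = occPred k p φ ∨ occPred k p ψ
occPred k p (imp φ ψ)      = occPred k p φ ∨ occPred k p ψ
occPred k p (iff φ ψ)      = occPred k p φ ∨ occPred k p ψ
occPred k p (all y φ)      = occPred k p φ
occPred k p (ex y φ)       = occPred k p φ
occPred k p (allP k' p' φ) = sameP k p k' p' ∨ occPred k p φ
occPred k p (exP k' p' φ)  = sameP k p k' p' ∨ occPred k p φ

freePred : (k p : ℕ) → Formula → Bool
freePred k p (eq y z)       = false
freePred k p (pv k' p' ys)  = sameP k p k' p'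
freePred k p (neg φ)        = freePred k p φ
freePred k p (and φ ψ)      = freePred k p φ ∨ freePred k p ψ
freePred k p (or φ ψ)       = freePred k p φ ∨ freePred k p ψ
freePred k p (imp φ ψ)      = freePred k p φ ∨ freePred k p ψ
freePred k p (iff φ ψ)      = freePred k p φ ∨ freePred k p ψ
freePred k p (all y φ)      = freePred k p φ
freePred k p (ex y φ)       = freePred k p φ
freePred k p (allP k' p' φ) = not (sameP k p k' p') ∧ freePred k p φ
freePred k p (exP k' p' φ)  = not (sameP k p k' p') ∧ freePred k p φ

Distinct : ∀ {n} → Vec ℕ n → Set
Distinct {n} xs = (i j : Fin n) → lookup xs i ≡ lookup xs j → i ≡ j

Pred : Set → ℕ → Set
Pred I k = Vec I (suc k) → Bool

-- A predicate structure (J_k): J_0 = I nonempty, ∅ ≠ J_{suc k} ⊆ pred_{suc k}(I).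
record Structure : Set₁ where
  field
    I    : Set
    inh  : I
    J    : (k : ℕ) → Pred I k → Set
    Jne  : (k : ℕ) → Σ (Pred I k) (J k)

module _ (𝔄 : Structure) where
  open Structure 𝔄

  record Assignment : Set where
    field
      ind : ℕ → I
      prd : (k p : ℕ) → Σ (Pred I k) (J k)

  open Assignment

  updI : Assignment → ℕ → I → Assignment
  ind (updI β x a) y = if y ≡ᵇ x then a else ind β y
  prd (updI β x a)   = prd β

  updP : Assignment → (k p : ℕ) → Σ (Pred I k) (J k) → Assignment
  ind (updP β k p R) = ind β
  prd (updP β k p R) k' p' with k' ≟ k | p' ≟ p
  ... | yes refl | yes refl = R
  ... | _        | _        = prd β k' p'

  Sat : Formula → Assignment → Set
  Sat (eq x y)     β = ind β x ≡ ind β y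
  Sat (pv k p xs)  β = proj₁ (prd β k p) (map (ind β) xs) ≡ true
  Sat (neg φ)      β = ¬ Sat φ β
  Sat (and φ ψ)    β = Sat φ β × Sat ψ β
  Sat (or φ ψ)     β = Sat φ β ⊎ Sat ψ β
  Sat (imp φ ψ)    β = Sat φ β → Sat ψ β
  Sat (iff φ ψ)    β = Sat φ β ⇔ Sat ψ β
  Sat (all x φ)    β = (a : I) → Sat φ (updI β x a)
  Sat (ex x φ)     β = Σ I λ a → Sat φ (updI β x a)
  Sat (allP k p φ) β = (R : Pred I k) (r : J k R) → Sat φ (updP β k p (R , r))
  Sat (exP k p φ)  β = Σ (Pred I k) λ R → Σ (J k R) λ r → Sat φ (updP β k p (R , r))

Valid : Structure → Formula → Set
Valid 𝔄 φ = (β : Assignment 𝔄) → Sat 𝔄 φ β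

FormulaSet : Set₁
FormulaSet = Formula → Set

_∪_ : FormulaSet → FormulaSet → FormulaSet
(Φ ∪ Ψ) φ = Φ φ ⊎ Ψ φ

Model : Structure → FormulaSet → Set
Model 𝔄 Φ = (φ : Formula) → Φ φ → Valid 𝔄 φ

comprehension : (k a : ℕ) → Vec ℕ (suc k) → Formula → Formula
comprehension k a xs G = exP k a (allV xs (iff (pv k a xs) G))

hax2 : FormulaSet
hax2 φ = Σ ℕ λ k → Σ ℕ λ a → Σ (Vec ℕ (suc k)) λ xs → Σ Formula λ G →
         Distinct xs × (freePred k a G ≡ false) × (φ ≡ comprehension k a xs G)

HenkinAsser : Structure → Set
HenkinAsser 𝔄 = Model 𝔄 hax2

Follows : FormulaSet → Formula → Set₁
Follows Φ φ = (𝔄 : Structure) → HenkinAsser 𝔄 → Model 𝔄 Φ → Valid 𝔄 φ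

-- choice_h = ⋃_{n,m ≥ 1} choice_h^{n,m}; here n = suc n', m = suc m'.
-- D = (m' , d) is m-ary, S = (n' + suc m' , s) is (n+m)-ary.

choiceFormula : (n' m' : ℕ) → Formula → Vec ℕ (suc n') → Vec ℕ (suc m') → (d s : ℕ) → Formula
choiceFormula n' m' H xs ys d s =
  imp (allV xs (exP m' d H))
      (exP (n' + suc m') s
        (allV xs (exP m' d
          (and (allV ys (iff (pv m' d ys) (pv (n' + suc m') s (xs ++ ys)))) H))))

choiceh : FormulaSet
choiceh φ = Σ ℕ λ n' → Σ ℕ λ m' → Σ Formula λ H →
            Σ (Vec ℕ (suc n')) λ xs → Σ (Vec ℕ (suc m')) λ ys → Σ ℕ λ d → Σ ℕ λ s →
            Distinct xs × Distinct ys ×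
            ((i : Fin (suc m')) → occInd (lookup ys i) H ≡ false) ×
            (occPred (n' + suc m') s H ≡ false) ×
            (φ ≡ choiceFormula n' m' H xs ys d s)

private
  x y z : ℕ
  x = 0
  y = 1
  z = 2

  A_ : ℕ → Formula
  A_ u = pv 0 0 (u ∷ [])
  B_ : ℕ → Formula
  B_ u = pv 0 1 (u ∷ [])
  T_ : ℕ → ℕ → Formula
  T_ u v = pv 1 0 (u ∷ v ∷ [])

wo : Formula
wo =
  and (all x (all y (imp (T_ x y) (and (A_ x) (A_ y)))))
  (and (all x (imp (A_ x) (T_ x x)))
  (and (all x (all y (imp (and (and (A_ x) (A_ y)) (and (T_ x y) (T_ y x))) (eq x y))))
  (and (all x (all y (all z (imp (and (and (A_ x) (and (A_ y) (A_ z))) (and (T_ x y) (T_ y z))) (T_ x z)))))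
  (and (all x (all y (imp (and (A_ x) (A_ y)) (or (T_ x y) (T_ y x)))))
       (allP 0 1 (imp (and (all x (imp (B_ x) (A_ x))) (ex x (B_ x)))
                      (ex x (and (B_ x) (all y (imp (B_ y) (T_ x y)))))))))))

WO1 : Formula
WO1 = allP 0 0 (exP 1 0 wo)

⟦_⟧ : Formula → FormulaSet
⟦ φ ⟧ ψ = ψ ≡ φ

-- The full second-order structure over a one-point set is a Henkin–Asser model of every choice axiom in
-- which WO¹ holds trivially.  For ¬WO¹ take the basic Fraenkel model: the individuals are the natural
-- numbers and the predicates are those with finite support, i.e. invariant under all permutations of ℕ
-- that fix some finite set pointwise.  Truth is invariant under isomorphisms, so a predicate defined by a
-- formula is supported by the finitely many values the formula sees, which gives comprehension; and a
-- well-ordering of ℕ would have to be invariant under the transposition of two points outside its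
-- support, which is impossible for an antisymmetric total relation.  Choice survives because a definable
-- choice problem is invariant under the permutations fixing its parameters: it suffices to choose solutions
-- at the finitely many canonical tuples (points beyond the parameters renamed to a fixed range) and to
-- transport them along permutations.

module Submission where

open import Defs
open import Axiom.ExcludedMiddle using (ExcludedMiddle)
open import Level using (0ℓ)
open import Data.Bool using (Bool; true; false; T; not; _∨_; _∧_; if_then_else_)
open import Data.Bool.Properties using (T-∨; T-∧)
open import Data.Empty using (⊥-elim)
open import Data.Fin using (Fin; zero; suc)
open import Data.Fin.Properties using (suc-injective; any?)
open import Data.Nat using (ℕ; zero; suc; _+_; _⊔_; _∸_; _<_; _≤_; _≟_; _<?_; _≡ᵇ_; s≤s; z<s; s<s)
open import Data.Nat.Properties
  using ( ≡ᵇ⇒≡; ≡⇒≡ᵇ; +-suc; m≢1+n+m; 1+n≢n; <⇒≢; m<n⇒m<1+n; m+n≮m; m+n∸m≡n; +-monoʳ-<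
        ; <-≤-trans; m≤m+n; ≤-refl; ≤-trans; m≤m⊔n; m≤n⊔m)
open import Data.Product using (Σ; ∃; _×_; _,_; proj₁; proj₂)
open import Data.Sum using (_⊎_; inj₁; inj₂; [_,_]) renaming (map to map-⊎)
open import Data.Unit using (⊤; tt)
open import Data.List using (List; []; _∷_; upTo) renaming (_++_ to _++ₗ_; map to mapₗ)
open import Data.List.Membership.Propositional using (_∈_; _∉_)
open import Data.List.Membership.Propositional.Properties
  using (∈-map⁺; ∈-map⁻; ∈-++⁺ˡ; ∈-++⁺ʳ; ∈-++⁻; ∈-upTo⁺)
open import Data.List.Membership.DecPropositional _≟_ using (_∈?_)
open import Data.List.Relation.Unary.Any using () renaming (here to hereₗ; there to thereₗ)
import Data.List.Relation.Unary.All as Allₗ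
open import Data.List.Extrema.Nat using (max; xs≤max)
open import Data.Vec using (Vec; []; _∷_; _++_; map; lookup; tabulate; take; drop; toList)
open import Data.Vec.Membership.Propositional.Properties
  using (∈-toList⁺) renaming (∈-map⁺ to ∈ᵥ-map⁺; ∈-lookup to ∈ᵥ-lookup)
open import Data.Vec.Properties
  using ( map-∘; map-cong; map-id; map-++; lookup-map; take-map; drop-map; ∷-injective
        ; tabulate∘lookup; tabulate-cong; take++drop≡id; ++-injectiveˡ; ++-injectiveʳ)
open import Data.Vec.Membership.Propositional using () renaming (_∈_ to _∈ᵥ_)
open import Data.Vec.Relation.Unary.Any using (here; there)
open import Function using (_∘_; id)
open import Function.Bundles using (mk⇔; Equivalence; _↔_; Inverse; mk↔ₛ′)
open import Function.Properties.Inverse using (↔-refl; ↔-sym; ↔-trans)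
open import Relation.Binary.PropositionalEquality hiding (J; [_])
open import Relation.Nullary using (¬_; yes; no; does; contradiction)

open Inverse using (to; from; strictlyInverseˡ; strictlyInverseʳ)

T-∨ˡ : ∀ {a b} → T a → T (a ∨ b)
T-∨ˡ = Equivalence.from T-∨ ∘ inj₁

T-∨ʳ : ∀ {a b} → T b → T (a ∨ b)
T-∨ʳ = Equivalence.from T-∨ ∘ inj₂

≡ᵇ-refl : ∀ x → T (x ≡ᵇ x)
≡ᵇ-refl x = ≡⇒≡ᵇ x x refl

sameP-refl : ∀ k p → T (sameP k p k p)
sameP-refl k p = Equivalence.from T-∧ (≡ᵇ-refl k , ≡ᵇ-refl p)

sameP⇒≡ : ∀ {k p k' p'} → T (sameP k p k' p') → k ≡ k' × p ≡ p'
sameP⇒≡ {k} {p} {k'} {p'} t with Equivalence.to T-∧ t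
... | tk , tp = ≡ᵇ⇒≡ k k' tk , ≡ᵇ⇒≡ p p' tp

not-sameP : ∀ {k p k' p'} → ¬ (k ≡ k' × p ≡ p') → T (not (sameP k p k' p'))
not-sameP {k} {p} {k'} {p'} ne with sameP k p k' p' in b≡
... | true  = contradiction (sameP⇒≡ (subst T (sym b≡) tt)) ne
... | false = tt

memV⇒∈ᵥ : ∀ {x n} (ys : Vec ℕ n) → T (memV x ys) → x ∈ᵥ ys
memV⇒∈ᵥ {x} (y ∷ ys) t with Equivalence.to T-∨ t
... | inj₁ x≡y = here (≡ᵇ⇒≡ x y x≡y)
... | inj₂ x∈ys = there (memV⇒∈ᵥ ys x∈ys)

∈ᵥ⇒memV : ∀ {x n} {ys : Vec ℕ n} → x ∈ᵥ ys → T (memV x ys)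
∈ᵥ⇒memV {x} (here refl) = T-∨ˡ (≡ᵇ-refl x)
∈ᵥ⇒memV (there p)       = T-∨ʳ (∈ᵥ⇒memV p)

map-cong-∈ᵥ : ∀ {A B : Set} {n} {f g : A → B} (xs : Vec A n) →
              (∀ {x} → x ∈ᵥ xs → f x ≡ g x) → map f xs ≡ map g xs
map-cong-∈ᵥ []       _   = refl
map-cong-∈ᵥ (x ∷ xs) f≡g = cong₂ _∷_ (f≡g (here refl)) (map-cong-∈ᵥ xs (f≡g ∘ there))

T-∨-map : ∀ {a b c d} → (T a → T c) → (T b → T d) → T (a ∨ b) → T (c ∨ d)
T-∨-map f g = Equivalence.from T-∨ ∘ map-⊎ f g ∘ Equivalence.to T-∨

freePred⇒occPred : ∀ k p φ → T (freePred k p φ) → T (occPred k p φ)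
freePred⇒occPred k p (eq x y)     ()
freePred⇒occPred k p (pv _ _ _)   t = t
freePred⇒occPred k p (neg φ)      t = freePred⇒occPred k p φ t
freePred⇒occPred k p (and φ ψ)    t = T-∨-map (freePred⇒occPred k p φ) (freePred⇒occPred k p ψ) t
freePred⇒occPred k p (or φ ψ)     t = T-∨-map (freePred⇒occPred k p φ) (freePred⇒occPred k p ψ) t
freePred⇒occPred k p (imp φ ψ)    t = T-∨-map (freePred⇒occPred k p φ) (freePred⇒occPred k p ψ) t
freePred⇒occPred k p (iff φ ψ)    t = T-∨-map (freePred⇒occPred k p φ) (freePred⇒occPred k p ψ) t
freePred⇒occPred k p (all x φ)    t = freePred⇒occPred k p φ t
freePred⇒occPred k p (ex x φ)     t = freePred⇒occPred k p φ t
freePred⇒occPred k p (allP _ _ φ) t = T-∨ʳ (freePred⇒occPred k p φ (proj₂ (Equivalence.to T-∧ t)))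
freePred⇒occPred k p (exP _ _ φ)  t = T-∨ʳ (freePred⇒occPred k p φ (proj₂ (Equivalence.to T-∧ t)))

freePred-under-binder : ∀ {k p k' p' φ} → T (freePred k' p' φ) → ¬ (k' ≡ k × p' ≡ p) →
                        T (not (sameP k' p' k p) ∧ freePred k' p' φ)
freePred-under-binder t ne = Equivalence.from T-∧ (not-sameP ne , t)

Distinct-tail : ∀ {n x} {xs : Vec ℕ n} → Distinct (x ∷ xs) → Distinct xs
Distinct-tail d i j e = suc-injective (d (suc i) (suc j) e)

Distinct-head : ∀ {n x} {xs : Vec ℕ n} → Distinct (x ∷ xs) → ∀ i → lookup xs i ≢ x
Distinct-head d i e with d zero (suc i) (sym e)
... | ()

module _ {A B : Set} (h : A ↔ B) where

  map-from∘to : ∀ {n} (v : Vec A n) → map (from h) (map (to h) v) ≡ v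
  map-from∘to v = trans (sym (map-∘ _ _ v)) (trans (map-cong (strictlyInverseʳ h) v) (map-id v))

  map-to∘from : ∀ {n} (v : Vec B n) → map (to h) (map (from h) v) ≡ v
  map-to∘from v = trans (sym (map-∘ _ _ v)) (trans (map-cong (strictlyInverseˡ h) v) (map-id v))

module _ {A : Set} {m n : ℕ} (u : Vec A m) (w : Vec A n) where

  take-++ : take m (u ++ w) ≡ u
  take-++ = ++-injectiveˡ (take m (u ++ w)) u (take++drop≡id m (u ++ w))

  drop-++ : drop m (u ++ w) ≡ w
  drop-++ = ++-injectiveʳ (take m (u ++ w)) u (take++drop≡id m (u ++ w))

Admissible : Structure → ℕ → Set
Admissible 𝔄 k = Σ (Pred (Structure.I 𝔄) k) (Structure.J 𝔄 k)

module _ {𝔄 : Structure} where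
  open Structure 𝔄
  open Assignment

  updIs : ∀ {n} → Assignment 𝔄 → Vec ℕ n → Vec I n → Assignment 𝔄
  updIs γ []       []      = γ
  updIs γ (x ∷ xs) (a ∷ v) = updIs (updI 𝔄 γ x a) xs v

  allV-elim : ∀ {n} (xs : Vec ℕ n) {φ γ} → Sat 𝔄 (allV xs φ) γ → ∀ v → Sat 𝔄 φ (updIs γ xs v)
  allV-elim []       s []      = s
  allV-elim (x ∷ xs) s (a ∷ v) = allV-elim xs (s a) v

  allV-intro : ∀ {n} (xs : Vec ℕ n) {φ γ} → (∀ v → Sat 𝔄 φ (updIs γ xs v)) → Sat 𝔄 (allV xs φ) γ
  allV-intro []       s   = s []
  allV-intro (x ∷ xs) s a = allV-intro xs (s ∘ (a ∷_))

  prd-updIs : ∀ {n} γ (xs : Vec ℕ n) v → prd (updIs γ xs v) ≡ prd γ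
  prd-updIs γ []       []      = refl
  prd-updIs γ (x ∷ xs) (a ∷ v) = prd-updIs (updI 𝔄 γ x a) xs v

  ind-updI-≡ : ∀ γ x a → ind (updI 𝔄 γ x a) x ≡ a
  ind-updI-≡ γ x a with x ≡ᵇ x in b≡
  ... | true  = refl
  ... | false = ⊥-elim (subst T b≡ (≡ᵇ-refl x))

  ind-updI-≢ : ∀ γ x a {y} → y ≢ x → ind (updI 𝔄 γ x a) y ≡ ind γ y
  ind-updI-≢ γ x a {y} y≢x with y ≡ᵇ x in b≡
  ... | true  = contradiction (≡ᵇ⇒≡ y x (subst T (sym b≡) tt)) y≢x
  ... | false = refl

  ind-updIs-∉ : ∀ {n} γ (xs : Vec ℕ n) v {y} → (∀ i → lookup xs i ≢ y) →
                ind (updIs γ xs v) y ≡ ind γ y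
  ind-updIs-∉ γ []       []      y∉ = refl
  ind-updIs-∉ γ (x ∷ xs) (a ∷ v) y∉ =
    trans (ind-updIs-∉ _ xs v (y∉ ∘ suc)) (ind-updI-≢ γ x a (y∉ zero ∘ sym))

  ind-updIs-lookup : ∀ {n} γ (xs : Vec ℕ n) v → Distinct xs →
                     ∀ i → ind (updIs γ xs v) (lookup xs i) ≡ lookup v i
  ind-updIs-lookup γ (x ∷ xs) (a ∷ v) d zero    =
    trans (ind-updIs-∉ _ xs v (Distinct-head {xs = xs} d)) (ind-updI-≡ γ x a)
  ind-updIs-lookup γ (x ∷ xs) (a ∷ v) d (suc i) =
    ind-updIs-lookup _ xs v (Distinct-tail {xs = xs} d) i

  map-ind-updIs : ∀ {n} γ {xs : Vec ℕ n} v → Distinct xs → map (ind (updIs γ xs v)) xs ≡ v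
  map-ind-updIs γ {xs} v d = begin
    map (ind (updIs γ xs v)) xs                     ≡⟨ tabulate∘lookup _ ⟨
    tabulate (lookup (map (ind (updIs γ xs v)) xs)) ≡⟨ tabulate-cong lookup≡ ⟩
    tabulate (lookup v)                             ≡⟨ tabulate∘lookup v ⟩
    v                                               ∎
    where
    open ≡-Reasoning
    lookup≡ : ∀ i → lookup (map (ind (updIs γ xs v)) xs) i ≡ lookup v i
    lookup≡ i = trans (lookup-map i _ xs) (ind-updIs-lookup γ xs v d i)

  prd-updP-≡ : ∀ γ k p R → prd (updP 𝔄 γ k p R) k p ≡ R
  prd-updP-≡ γ k p R with k ≟ k | p ≟ p
  ... | yes refl | yes refl = refl
  ... | no k≢k   | _        = contradiction refl k≢k
  ... | yes refl | no p≢p   = contradiction refl p≢p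

  prd-updP-≢ : ∀ γ k p R {k' p'} → ¬ (k' ≡ k × p' ≡ p) → prd (updP 𝔄 γ k p R) k' p' ≡ prd γ k' p'
  prd-updP-≢ γ k p R {k'} {p'} ne with k' ≟ k | p' ≟ p
  ... | yes refl | yes refl = contradiction (refl , refl) ne
  ... | no _     | _        = refl
  ... | yes refl | no _     = refl

-- Transport along isomorphisms

_∼[_]_ : ∀ {A B : Set} {k} → Pred A k → A ↔ B → Pred B k → Set
R ∼[ h ] R' = ∀ v → R' v ≡ R (map (from h) v)

∼-refl : ∀ {A : Set} {k} (R : Pred A k) → R ∼[ ↔-refl ] R
∼-refl R v = cong R (sym (map-id v))

∼-sym : ∀ {A B : Set} {k} {h : A ↔ B} {R : Pred A k} {R'} → R ∼[ h ] R' → R' ∼[ ↔-sym h ] R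
∼-sym {h = h} {R} R∼R' v = sym (trans (R∼R' (map (to h) v)) (cong R (map-from∘to h v)))

record _≅_ (𝔄 𝔅 : Structure) : Set where
  field
    bij   : Structure.I 𝔄 ↔ Structure.I 𝔅
    forth : ∀ {k} (R : Admissible 𝔄 k) → ∃ λ (R' : Admissible 𝔅 k) → proj₁ R ∼[ bij ] proj₁ R'
    back  : ∀ {k} (R' : Admissible 𝔅 k) → ∃ λ (R : Admissible 𝔄 k) → proj₁ R ∼[ bij ] proj₁ R'

open _≅_

≅-refl : ∀ {𝔄} → 𝔄 ≅ 𝔄
≅-refl = record { bij = ↔-refl ; forth = λ R → R , ∼-refl (proj₁ R) ; back = λ R → R , ∼-refl (proj₁ R) }

≅-sym : ∀ {𝔄 𝔅} → 𝔄 ≅ 𝔅 → 𝔅 ≅ 𝔄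
≅-sym iso = record
  { bij   = ↔-sym (bij iso)
  ; forth = λ R → let R' , R'∼R = back iso R in R' , ∼-sym {h = bij iso} {R = proj₁ R'} R'∼R
  ; back  = λ R → let R' , R∼R' = forth iso R in R' , ∼-sym {h = bij iso} {R = proj₁ R} R∼R'
  }

record Related {𝔄 𝔅} (iso : 𝔄 ≅ 𝔅) (X : ℕ → Set) (Y : ℕ → ℕ → Set)
               (γ : Assignment 𝔄) (γ' : Assignment 𝔅) : Set where
  field
    ind-rel : ∀ {x} → X x → Assignment.ind γ' x ≡ to (bij iso) (Assignment.ind γ x)
    prd-rel : ∀ {k p} → Y k p → proj₁ (Assignment.prd γ k p) ∼[ bij iso ] proj₁ (Assignment.prd γ' k p)

open Related

RelatedOn : ∀ {𝔄 𝔅} → 𝔄 ≅ 𝔅 → Formula → Assignment 𝔄 → Assignment 𝔅 → Set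
RelatedOn iso φ = Related iso (λ x → T (occInd x φ)) (λ k p → T (freePred k p φ))

module _ {𝔄 𝔅 : Structure} {iso : 𝔄 ≅ 𝔅} where
  open Assignment

  Related-mono : ∀ {X X' Y Y' γ γ'} → (∀ {x} → X' x → X x) → (∀ {k p} → Y' k p → Y k p) →
                 Related iso X Y γ γ' → Related iso X' Y' γ γ'
  Related-mono X'⊆X Y'⊆Y r = record { ind-rel = ind-rel r ∘ X'⊆X ; prd-rel = prd-rel r ∘ Y'⊆Y }

  Related-sym : ∀ {X Y γ γ'} → Related iso X Y γ γ' → Related (≅-sym iso) X Y γ' γ
  Related-sym {γ = γ} r = record
    { ind-rel = λ {x} Xx → sym (trans (cong (from (bij iso)) (ind-rel r Xx))
                                      (strictlyInverseʳ (bij iso) (ind γ x)))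
    ; prd-rel = λ {k} {p} Ykp → ∼-sym {h = bij iso} {R = proj₁ (prd γ k p)} (prd-rel r Ykp) }

  Related-updI : ∀ {X Y γ γ'} y {a b} → b ≡ to (bij iso) a → Related iso X Y γ γ' →
                 Related iso X Y (updI 𝔄 γ y a) (updI 𝔅 γ' y b)
  Related-updI {X} {Y} {γ} {γ'} y {a} {b} b≡ r = record { ind-rel = rel ; prd-rel = prd-rel r }
    where
    rel : ∀ {x} → X x → ind (updI 𝔅 γ' y b) x ≡ to (bij iso) (ind (updI 𝔄 γ y a) x)
    rel {x} Xx with x ≡ᵇ y
    ... | true  = b≡
    ... | false = ind-rel r Xx

  Related-updIs : ∀ {n X Y γ γ'} (xs : Vec ℕ n) v → Related iso X Y γ γ' →
                  Related iso X Y (updIs γ xs v) (updIs γ' xs (map (to (bij iso)) v))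
  Related-updIs []       []      r = r
  Related-updIs (x ∷ xs) (a ∷ v) r = Related-updIs xs v (Related-updI x refl r)

  Related-updP : ∀ {X Y Y' γ γ'} k p {R R'} → proj₁ R ∼[ bij iso ] proj₁ R' →
                 (∀ {k' p'} → Y' k' p' → ¬ (k' ≡ k × p' ≡ p) → Y k' p') → Related iso X Y γ γ' →
                 Related iso X Y' (updP 𝔄 γ k p R) (updP 𝔅 γ' k p R')
  Related-updP {X} {Y} {Y'} {γ} {γ'} k p {R} {R'} R∼R' Y'⊆Y r =
    record { ind-rel = ind-rel r ; prd-rel = rel }
    where
    rel : ∀ {k' p'} → Y' k' p' →
          proj₁ (prd (updP 𝔄 γ k p R) k' p') ∼[ bij iso ] proj₁ (prd (updP 𝔅 γ' k p R') k' p')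
    rel {k'} {p'} Y'kp with k' ≟ k | p' ≟ p
    ... | yes refl | yes refl = R∼R'
    ... | no k'≢k  | _        = prd-rel r (Y'⊆Y Y'kp (k'≢k ∘ proj₁))
    ... | yes refl | no p'≢p  = prd-rel r (Y'⊆Y Y'kp (p'≢p ∘ proj₂))

  Related-∨ˡ : ∀ {a b : ℕ → Bool} {c d : ℕ → ℕ → Bool} {γ γ'} →
               Related iso (λ x → T (a x ∨ b x)) (λ k p → T (c k p ∨ d k p)) γ γ' →
               Related iso (λ x → T (a x)) (λ k p → T (c k p)) γ γ'
  Related-∨ˡ = Related-mono T-∨ˡ T-∨ˡ

  Related-∨ʳ : ∀ {a b : ℕ → Bool} {c d : ℕ → ℕ → Bool} {γ γ'} →
               Related iso (λ x → T (a x ∨ b x)) (λ k p → T (c k p ∨ d k p)) γ γ' →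
               Related iso (λ x → T (b x)) (λ k p → T (d k p)) γ γ'
  Related-∨ʳ = Related-mono T-∨ʳ T-∨ʳ

Related-refl : ∀ {𝔄 X Y} {γ : Assignment 𝔄} → Related ≅-refl X Y γ γ
Related-refl {γ = γ} = record
  { ind-rel = λ _ → refl ; prd-rel = λ {k} {p} _ → ∼-refl (proj₁ (Assignment.prd γ k p)) }

-- For iso = ≅-refl this is the coincidence lemma.
transport : ∀ {𝔄 𝔅} (iso : 𝔄 ≅ 𝔅) φ {γ γ'} → RelatedOn iso φ γ γ' → Sat 𝔄 φ γ → Sat 𝔅 φ γ'
transport iso (eq x y) r s =
  trans (ind-rel r {x} (T-∨ˡ (≡ᵇ-refl x)))
        (trans (cong (to (bij iso)) s) (sym (ind-rel r {y} (T-∨ʳ (≡ᵇ-refl y)))))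
transport iso (pv k p ys) {γ} {γ'} r s =
  trans (prd-rel r (sameP-refl k p) (map (ind γ') ys)) (trans (cong (proj₁ (prd γ k p)) args) s)
  where
  open Assignment
  args : map (from (bij iso)) (map (ind γ') ys) ≡ map (ind γ) ys
  args = trans (sym (map-∘ _ _ ys)) (map-cong-∈ᵥ ys λ {x} x∈ys →
           trans (cong (from (bij iso)) (ind-rel r (∈ᵥ⇒memV x∈ys))) (strictlyInverseʳ (bij iso) _))
transport iso (neg φ) r s t = s (transport (≅-sym iso) φ (Related-sym r) t)
transport iso (and φ ψ) r (s , t) = transport iso φ (Related-∨ˡ r) s , transport iso ψ (Related-∨ʳ r) t
transport iso (or φ ψ) r (inj₁ s) = inj₁ (transport iso φ (Related-∨ˡ r) s)
transport iso (or φ ψ) r (inj₂ t) = inj₂ (transport iso ψ (Related-∨ʳ r) t)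
transport iso (imp φ ψ) r s t =
  transport iso ψ (Related-∨ʳ r) (s (transport (≅-sym iso) φ (Related-sym (Related-∨ˡ r)) t))
transport iso (iff φ ψ) r s = mk⇔
  (λ t → transport iso ψ (Related-∨ʳ r)
           (Equivalence.to s (transport (≅-sym iso) φ (Related-sym (Related-∨ˡ r)) t)))
  (λ t → transport iso φ (Related-∨ˡ r)
           (Equivalence.from s (transport (≅-sym iso) ψ (Related-sym (Related-∨ʳ r)) t)))
transport iso (all y φ) r s b =
  transport iso φ (Related-updI y (sym (strictlyInverseˡ (bij iso) b)) (Related-mono T-∨ʳ id r))
    (s (from (bij iso) b))
transport iso (ex y φ) r (a , s) =
  to (bij iso) a , transport iso φ (Related-updI y refl (Related-mono T-∨ʳ id r)) s
transport iso (allP k p φ) r s R' j' =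
  let (R , j) , R∼R' = back iso (R' , j') in
  transport iso φ (Related-updP k p R∼R' (freePred-under-binder {φ = φ}) r) (s R j)
transport iso (exP k p φ) r (R , j , s) =
  let (R' , j') , R∼R' = forth iso (R , j) in
  R' , j' , transport iso φ (Related-updP k p R∼R' (freePred-under-binder {φ = φ}) r) s

module _ {𝔄 : Structure} where
  open Structure 𝔄
  open Assignment

  updIs-updP-related : ∀ {n} γ (xs : Vec ℕ n) v k p R →
    Related ≅-refl (λ _ → ⊤) (λ k' p' → ¬ (k' ≡ k × p' ≡ p)) (updIs γ xs v) (updIs (updP 𝔄 γ k p R) xs v)
  updIs-updP-related γ xs v k p R =
    subst (λ v' → Related ≅-refl (λ _ → ⊤) (λ k' p' → ¬ (k' ≡ k × p' ≡ p))
                    (updIs γ xs v) (updIs (updP 𝔄 γ k p R) xs v'))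
      (map-id v) (Related-updIs xs v record
      { ind-rel = λ _ → refl
      ; prd-rel = λ {k'} {p'} ne w → trans (cong (λ Q → proj₁ Q w) (prd-updP-≢ γ k p R ne))
                                           (∼-refl (proj₁ (prd γ k' p')) w) })

  pv-updIs : ∀ (γ : Assignment 𝔄) k p (xs : Vec ℕ (suc k)) (v : Vec I (suc k)) → Distinct xs →
             proj₁ (prd (updIs γ xs v) k p) (map (ind (updIs γ xs v)) xs) ≡ proj₁ (prd γ k p) v
  pv-updIs γ k p xs v d = begin
    proj₁ (prd (updIs γ xs v) k p) (map (ind (updIs γ xs v)) xs)
      ≡⟨ cong (λ P → proj₁ (P k p) (map (ind (updIs γ xs v)) xs)) (prd-updIs γ xs v) ⟩
    proj₁ (prd γ k p) (map (ind (updIs γ xs v)) xs)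
      ≡⟨ cong (proj₁ (prd γ k p)) (map-ind-updIs γ {xs} v d) ⟩
    proj₁ (prd γ k p) v ∎
    where open ≡-Reasoning

-- Predicates are Bool-valued, so a formula defines one only with the help of excluded middle.
module Classical (em : ExcludedMiddle 0ℓ) where

  holds : Set → Bool
  holds P = does (em {P})

  holds⇒ : ∀ {P} → holds P ≡ true → P
  holds⇒ {P} _ with em {P}
  ... | yes p = p

  ⇒holds : ∀ {P} → P → holds P ≡ true
  ⇒holds {P} p with em {P}
  ... | yes _  = refl
  ... | no ¬p = contradiction p ¬p

  holds-cong : ∀ {P Q} → (P → Q) → (Q → P) → holds P ≡ holds Q
  holds-cong {P} {Q} P→Q Q→P with em {P} | em {Q}
  ... | yes _ | yes _  = refl
  ... | no _  | no _   = refl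
  ... | yes p | no ¬q = contradiction (P→Q p) ¬q
  ... | no ¬p | yes q = contradiction (Q→P q) ¬p

  module _ {𝔄 : Structure} where
    open Structure 𝔄
    open Assignment

    definedBy : ∀ {k} → Formula → Vec ℕ (suc k) → Assignment 𝔄 → Pred I k
    definedBy G xs β v = holds (Sat 𝔄 G (updIs β xs v))

    definable⇒HenkinAsser : (∀ {k} G (xs : Vec ℕ (suc k)) β → J k (definedBy G xs β)) → HenkinAsser 𝔄
    definable⇒HenkinAsser definable _ (k , a , xs , G , dist , a∉G , refl) β =
      proj₁ A , proj₂ A , allV-intro xs λ v → mk⇔ (A⇒G v) (G⇒A v)
      where
      A : Admissible 𝔄 k
      A = definedBy G xs β , definable G xs β
      β' = updP 𝔄 β k a A
      A-at : ∀ v → proj₁ (prd (updIs β' xs v) k a) (map (ind (updIs β' xs v)) xs) ≡ definedBy G xs β v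
      A-at v = trans (pv-updIs β' k a xs v dist) (cong (λ Q → proj₁ Q v) (prd-updP-≡ β k a A))
      not-A : ∀ {k' p'} → T (freePred k' p' G) → ¬ (k' ≡ k × p' ≡ a)
      not-A t (refl , refl) = subst T a∉G t
      related : ∀ v → RelatedOn ≅-refl G (updIs β xs v) (updIs β' xs v)
      related v = Related-mono _ not-A (updIs-updP-related β xs v k a A)
      A⇒G : ∀ v → Sat 𝔄 (pv k a xs) (updIs β' xs v) → Sat 𝔄 G (updIs β' xs v)
      A⇒G v A-holds = transport ≅-refl G (related v) (holds⇒ (trans (sym (A-at v)) A-holds))
      G⇒A : ∀ v → Sat 𝔄 G (updIs β' xs v) → Sat 𝔄 (pv k a xs) (updIs β' xs v)
      G⇒A v G-holds = trans (A-at v) (⇒holds (transport (≅-sym ≅-refl) G (Related-sym (related v)) G-holds))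

module _ {𝔄 : Structure} where
  open Structure 𝔄
  open Assignment

  updIs-values-related : ∀ {n} {X : ℕ → Set} {Y : ℕ → ℕ → Set} (γ : Assignment 𝔄) (xs : Vec ℕ n) v v' →
    (∀ {x} → X x → ind (updIs γ xs v') x ≡ ind (updIs γ xs v) x) →
    Related ≅-refl X Y (updIs γ xs v) (updIs γ xs v')
  updIs-values-related γ xs v v' ind≡ = record
    { ind-rel = ind≡
    ; prd-rel = λ {k} {p} _ w → begin
        proj₁ (prd (updIs γ xs v') k p) w         ≡⟨ cong (λ P → proj₁ (P k p) w) (prd-updIs γ xs v') ⟩
        proj₁ (prd γ k p) w                       ≡⟨ ∼-refl (proj₁ (prd γ k p)) w ⟩
        proj₁ (prd γ k p) (map id w)
          ≡⟨ cong (λ P → proj₁ (P k p) (map id w)) (prd-updIs γ xs v) ⟨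
        proj₁ (prd (updIs γ xs v) k p) (map id w) ∎ }
    where open ≡-Reasoning

  erase : ∀ {n} → Vec Bool n → Vec I n → Vec I n
  erase []       []      = []
  erase (b ∷ bs) (a ∷ v) = (if b then a else inh) ∷ erase bs v

  lookup-erase : ∀ {n} bs (v : Vec I n) i → T (lookup bs i) → lookup (erase bs v) i ≡ lookup v i
  lookup-erase (true ∷ bs) (a ∷ v) zero    _ = refl
  lookup-erase (b ∷ bs)    (a ∷ v) (suc i) t = lookup-erase bs v i t

  erase-cong : ∀ {n} bs (v v' : Vec I n) → (∀ i → T (lookup bs i) → lookup v i ≡ lookup v' i) →
               erase bs v ≡ erase bs v'
  erase-cong []          []      []        _  = refl
  erase-cong (true ∷ bs) (a ∷ v) (a' ∷ v') same = cong₂ _∷_ (same zero tt) (erase-cong bs v v' (same ∘ suc))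
  erase-cong (false ∷ bs) (a ∷ v) (a' ∷ v') same = cong (inh ∷_) (erase-cong bs v v' (same ∘ suc))

  erase-map : ∀ {n} {h : I → I} → h inh ≡ inh → ∀ bs (v : Vec I n) → erase bs (map h v) ≡ map h (erase bs v)
  erase-map h-inh []           []      = refl
  erase-map h-inh (true ∷ bs)  (a ∷ v) = cong (_ ∷_) (erase-map h-inh bs v)
  erase-map h-inh (false ∷ bs) (a ∷ v) = cong₂ _∷_ (sym h-inh) (erase-map h-inh bs v)

  ind-updIs-erase : ∀ {n} (γ : Assignment 𝔄) (xs : Vec ℕ n) v (keep : ℕ → Bool) → Distinct xs →
                    ∀ {x} → T (keep x) →
                    ind (updIs γ xs (erase (map keep xs) v)) x ≡ ind (updIs γ xs v) x
  ind-updIs-erase γ xs v keep dist {x} kept with any? (λ i → lookup xs i ≟ x)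
  ... | yes (i , refl) = begin
    ind (updIs γ xs (erase (map keep xs) v)) (lookup xs i) ≡⟨ ind-updIs-lookup γ xs _ dist i ⟩
    lookup (erase (map keep xs) v) i                      ≡⟨ lookup-erase (map keep xs) v i kept-i ⟩
    lookup v i                                            ≡⟨ ind-updIs-lookup γ xs v dist i ⟨
    ind (updIs γ xs v) (lookup xs i)                      ∎
    where
    open ≡-Reasoning
    kept-i = subst T (sym (lookup-map i keep xs)) kept
  ... | no x∉xs = trans (ind-updIs-∉ γ xs _ x∉) (sym (ind-updIs-∉ γ xs v x∉))
    where x∉ = λ i e → x∉xs (i , e)

  section : ∀ {n' m'} → Pred I (n' + suc m') → Vec I (suc n') → Pred I m'
  section S u w = S (u ++ w)

  EraseClosed : Set
  EraseClosed = ∀ {n' m'} (mask : Vec Bool (suc n')) (S : Pred I (n' + suc m')) → J _ S →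
                J _ (λ z → S (erase mask (take (suc n') z) ++ drop (suc n') z))

  DefinableChoice : Set
  DefinableChoice = ∀ {n' m'} H β (xs : Vec ℕ (suc n')) d →
    (∀ u → Σ (Admissible 𝔄 m') λ D → Sat 𝔄 H (updP 𝔄 (updIs β xs u) m' d D)) →
    Σ (Admissible 𝔄 (n' + suc m')) λ S → ∀ u → Σ (J m' (section (proj₁ S) u)) λ j →
      Sat 𝔄 H (updP 𝔄 (updIs β xs u) m' d (section (proj₁ S) u , j))

  definableChoice⇒choiceh : EraseClosed → DefinableChoice → Model 𝔄 choiceh
  definableChoice⇒choiceh closed choose _
    (n' , m' , H , xs , ys , d , s , dist-xs , dist-ys , ys∉H , s∉H , refl) β total =
    S , jS , allV-intro xs λ v → D v , jD v , allV-intro ys (D-section v) , H-holds v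
    where
    K = n' + suc m'
    mask : Vec Bool (suc n')
    mask = map (λ x → occInd x H) xs
    chosen = choose H β xs d λ u → let D , j , h = allV-elim xs total u in (D , j) , h
    S₀ : Pred I K
    S₀ = proj₁ (proj₁ chosen)
    -- A variable of xs that does not occur in H may be rebound in ys, so S must ignore its coordinate.
    S : Pred I K
    S z = S₀ (erase mask (take (suc n') z) ++ drop (suc n') z)
    jS : J K S
    jS = closed mask S₀ (proj₂ (proj₁ chosen))
    β₁ = updP 𝔄 β K s (S , jS)
    D : Vec I (suc n') → Pred I m'
    D v = section S₀ (erase mask v)
    jD : ∀ v → J m' (D v)
    jD v = proj₁ (proj₂ chosen (erase mask v))
    γ : Vec I (suc n') → Assignment 𝔄
    γ v = updP 𝔄 (updIs β₁ xs v) m' d (D v , jD v)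

    S∉H : ∀ {k' p'} → T (freePred k' p' H) → ¬ (k' ≡ K × p' ≡ s)
    S∉H t (refl , refl) = subst T s∉H (freePred⇒occPred K s H t)

    H-holds : ∀ v → Sat 𝔄 H (γ v)
    H-holds v =
      transport ≅-refl H (Related-updP m' d {D v , jD v} (∼-refl (D v)) (λ t _ → S∉H t)
                            (Related-mono _ id (updIs-updP-related β xs v K s (S , jS))))
     (transport ≅-refl H (Related-updP m' d {D v , jD v} (∼-refl (D v)) (λ t _ → t)
                            (updIs-values-related β xs (erase mask v) v
                               (sym ∘ ind-updIs-erase β xs v (λ x → occInd x H) dist-xs)))
      (proj₂ (proj₂ chosen (erase mask v))))

    D-section : ∀ v w → Sat 𝔄 (iff (pv m' d ys) (pv K s (xs ++ ys))) (updIs (γ v) ys w)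
    D-section v w = mk⇔ (λ l → trans rhs-value (trans (sym lhs-value) l))
                        (λ r → trans lhs-value (trans (sym rhs-value) r))
      where
      open ≡-Reasoning
      γw = updIs (γ v) ys w
      xs-values = map (ind γw) xs
      lhs-value : proj₁ (prd γw m' d) (map (ind γw) ys) ≡ D v w
      lhs-value = trans (pv-updIs (γ v) m' d ys w dist-ys)
                        (cong (λ Q → proj₁ Q w) (prd-updP-≡ (updIs β₁ xs v) m' d (D v , jD v)))
      K≢m' : K ≢ m'
      K≢m' K≡m' = m≢1+n+m m' (sym (trans (sym (+-suc n' m')) K≡m'))
      kept-values : ∀ i → T (lookup mask i) → lookup xs-values i ≡ lookup v i
      kept-values i kept = trans (lookup-map i (ind γw) xs)
        (trans (ind-updIs-∉ (γ v) ys w not-in-ys) (ind-updIs-lookup β₁ xs v dist-xs i))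
        where
        not-in-ys : ∀ j → lookup ys j ≢ lookup xs i
        not-in-ys j e = subst T (trans (cong (λ x → occInd x H) (sym e)) (ys∉H j))
                                (subst T (lookup-map i (λ x → occInd x H) xs) kept)
      rhs-value : proj₁ (prd γw K s) (map (ind γw) (xs ++ ys)) ≡ D v w
      rhs-value = begin
        proj₁ (prd γw K s) (map (ind γw) (xs ++ ys))
          ≡⟨ cong (λ P → proj₁ (P K s) (map (ind γw) (xs ++ ys))) (prd-updIs (γ v) ys w) ⟩
        proj₁ (prd (γ v) K s) (map (ind γw) (xs ++ ys))
          ≡⟨ cong (λ Q → proj₁ Q (map (ind γw) (xs ++ ys)))
                  (prd-updP-≢ (updIs β₁ xs v) m' d _ (K≢m' ∘ proj₁)) ⟩
        proj₁ (prd (updIs β₁ xs v) K s) (map (ind γw) (xs ++ ys))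
          ≡⟨ cong (λ P → proj₁ (P K s) (map (ind γw) (xs ++ ys))) (prd-updIs β₁ xs v) ⟩
        proj₁ (prd β₁ K s) (map (ind γw) (xs ++ ys))
          ≡⟨ cong (λ Q → proj₁ Q (map (ind γw) (xs ++ ys))) (prd-updP-≡ β K s (S , jS)) ⟩
        S (map (ind γw) (xs ++ ys))
          ≡⟨ cong S (trans (map-++ (ind γw) xs ys)
                           (cong (xs-values ++_) (map-ind-updIs (γ v) {ys} w dist-ys))) ⟩
        S (xs-values ++ w)
          ≡⟨ cong₂ (λ a b → S₀ (erase mask a ++ b)) (take-++ xs-values w) (drop-++ xs-values w) ⟩
        S₀ (erase mask xs-values ++ w)
          ≡⟨ cong (λ a → S₀ (a ++ w)) (erase-cong mask xs-values v kept-values) ⟩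
        D v w ∎

full : (I : Set) → I → Structure
full I a = record { I = I ; inh = a ; J = λ _ _ → ⊤ ; Jne = λ _ → (λ _ → true) , tt }

full-choiceh : ∀ {I} {a : I} → Model (full I a) choiceh
full-choiceh {I} {a} = definableChoice⇒choiceh (λ _ _ _ → tt) choose
  where
  choose : DefinableChoice {full I a}
  choose {n'} {m'} H β xs d total = (S , tt) , λ u → tt ,
    transport ≅-refl H
      (Related-updP m' d (S-section u) (λ t _ → t) (Related-refl {Y = λ k p → T (freePred k p H)}))
      (proj₂ (total u))
    where
    S : Pred I (n' + suc m')
    S z = proj₁ (proj₁ (total (take (suc n') z))) (drop (suc n') z)
    S-section : ∀ u → proj₁ (proj₁ (total u)) ∼[ ↔-refl ] section {full I a} {n'} {m'} S u
    S-section u w = trans (cong₂ (λ u' w' → proj₁ (proj₁ (total u')) w') (take-++ u w) (drop-++ u w))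
                          (∼-refl (proj₁ (proj₁ (total u))) w)

WO1-full-⊤ : Valid (full ⊤ tt) WO1
WO1-full-⊤ β A _ = (λ _ → A (tt ∷ [])) , tt ,
  (λ _ _ T-holds → T-holds , T-holds) , (λ _ A-holds → A-holds) , (λ _ _ _ → refl) ,
  (λ _ _ _ A∧T → proj₂ (proj₂ A∧T)) , (λ _ _ A∧A → inj₁ (proj₁ A∧A)) ,
  λ _ _ (B⊆A , x₀ , B-x₀) → x₀ , B-x₀ , B⊆A

Perm : Set
Perm = ℕ ↔ ℕ

Fixes : (ℕ → Set) → Perm → Set
Fixes X π = ∀ {e} → X e → to π e ≡ e

Fixes-sym : ∀ {X} π → Fixes X π → Fixes X (↔-sym π)
Fixes-sym π fixed {e} Xe = trans (cong (from π) (sym (fixed Xe))) (strictlyInverseʳ π e)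

to-injective : ∀ (π : Perm) {a b} → to π a ≡ to π b → a ≡ b
to-injective π {a} {b} e = trans (sym (strictlyInverseʳ π a)) (trans (cong (from π) e) (strictlyInverseʳ π b))

swap : ℕ → ℕ → ℕ → ℕ
swap a b x with x ≟ a
... | yes _ = b
... | no _ with x ≟ b
...   | yes _ = a
...   | no _  = x

swap-left : ∀ a b → swap a b a ≡ b
swap-left a b with a ≟ a
... | yes _   = refl
... | no a≢a = contradiction refl a≢a

swap-right : ∀ a b → swap a b b ≡ a
swap-right a b with b ≟ a
... | yes b≡a = b≡a
... | no _ with b ≟ b
...   | yes _   = refl
...   | no b≢b = contradiction refl b≢b

swap-other : ∀ a b {x} → x ≢ a → x ≢ b → swap a b x ≡ x
swap-other a b {x} x≢a x≢b with x ≟ a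
... | yes x≡a = contradiction x≡a x≢a
... | no _ with x ≟ b
...   | yes x≡b = contradiction x≡b x≢b
...   | no _    = refl

swap-involutive : ∀ a b x → swap a b (swap a b x) ≡ x
swap-involutive a b x with x ≟ a
... | yes refl = swap-right x b
... | no x≢a with x ≟ b
...   | yes refl = swap-left a x
...   | no x≢b   = swap-other a b x≢a x≢b

transposition : ℕ → ℕ → Perm
transposition a b = mk↔ₛ′ (swap a b) (swap a b) (swap-involutive a b) (swap-involutive a b)

-- π' ⁻¹ ∘ σ ∘ π
conjugate : Perm → Perm → Perm → Perm
conjugate π σ π' = ↔-trans π (↔-trans σ (↔-sym π'))

map-conjugate : ∀ π σ π' {n} (w : Vec ℕ n) →
                map (from π') (map (to σ) w) ≡ map (to (conjugate π σ π')) (map (from π) w)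
map-conjugate π σ π' w = trans (sym (map-∘ _ _ w))
  (trans (map-cong (λ x → cong (from π' ∘ to σ) (sym (strictlyInverseˡ π x))) w) (map-∘ _ _ w))

act : ∀ {k} → Perm → (Vec ℕ k → Bool) → Vec ℕ k → Bool
act π R v = R (map (from π) v)

SupportedBy : ∀ {k} → (Vec ℕ k → Bool) → (ℕ → Set) → Set
SupportedBy R X = ∀ σ → Fixes X σ → ∀ v → R (map (to σ) v) ≡ R v

module _ {k} {R : Vec ℕ k → Bool} {X : ℕ → Set} where

  SupportedBy-mono : ∀ {Y} → (∀ {e} → X e → Y e) → SupportedBy R X → SupportedBy R Y
  SupportedBy-mono X⊆Y supp σ fixed = supp σ (fixed ∘ X⊆Y)

  SupportedBy-≗ : ∀ {R'} → (∀ v → R v ≡ R' v) → SupportedBy R X → SupportedBy R' X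
  SupportedBy-≗ R≗R' supp σ fixed v = trans (sym (R≗R' _)) (trans (supp σ fixed v) (R≗R' v))

  SupportedBy-act : ∀ π → SupportedBy R X → SupportedBy (act π R) (X ∘ from π)
  SupportedBy-act π supp σ fixed v =
    trans (cong R (map-conjugate π σ π v)) (supp (conjugate π σ π) conj-fixes (map (from π) v))
    where
    conj-fixes : Fixes X (conjugate π σ π)
    conj-fixes {e} Xe = trans (cong (from π) (fixed (subst X (sym (strictlyInverseʳ π e)) Xe)))
                              (strictlyInverseʳ π e)

FinitelySupported : ∀ {k} → (Vec ℕ k → Bool) → Set
FinitelySupported R = Σ (List ℕ) λ K → SupportedBy R (_∈ K)

FinitelySupported-act : ∀ {k} {R : Vec ℕ k → Bool} π → FinitelySupported R → FinitelySupported (act π R)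
FinitelySupported-act π (K , supp) = mapₗ (to π) K , SupportedBy-mono moved (SupportedBy-act π supp)
  where
  moved : ∀ {e} → from π e ∈ K → e ∈ mapₗ (to π) K
  moved {e} e∈ = subst (_∈ mapₗ (to π) K) (strictlyInverseˡ π e) (∈-map⁺ (to π) e∈)

-- The basic Fraenkel model: predicates on ℕ with finite support

permutationModel : Structure
permutationModel = record
  { I = ℕ ; inh = 0 ; J = λ _ → FinitelySupported ; Jne = λ _ → (λ _ → true) , [] , λ _ _ _ → refl }

support : ∀ {k} → Admissible permutationModel k → List ℕ
support R = proj₁ (proj₂ R)

permutationModel-≅ : Perm → permutationModel ≅ permutationModel
permutationModel-≅ σ = record
  { bij   = σ
  ; forth = λ (R , fs) → (act σ R , FinitelySupported-act σ fs) , λ _ → refl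
  ; back  = λ (R , fs) → (act (↔-sym σ) R , FinitelySupported-act (↔-sym σ) fs) ,
                         λ v → cong R (sym (map-to∘from σ v)) }

module _ where
  open Assignment

  params : Formula → Assignment permutationModel → List ℕ
  params (eq x y)     β = ind β x ∷ ind β y ∷ []
  params (pv k p xs)  β = toList (map (ind β) xs) ++ₗ support (prd β k p)
  params (neg φ)      β = params φ β
  params (and φ ψ)    β = params φ β ++ₗ params ψ β
  params (or φ ψ)     β = params φ β ++ₗ params ψ β
  params (imp φ ψ)    β = params φ β ++ₗ params ψ β
  params (iff φ ψ)    β = params φ β ++ₗ params ψ β
  params (all x φ)    β = ind β x ∷ params φ β
  params (ex x φ)     β = ind β x ∷ params φ β
  params (allP _ _ φ) β = params φ β
  params (exP _ _ φ)  β = params φ β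

  ∈-++-either : ∀ {a b : Bool} {e : ℕ} xs ys → (T a → e ∈ xs) → (T b → e ∈ ys) → T (a ∨ b) → e ∈ xs ++ₗ ys
  ∈-++-either xs ys ∈xs ∈ys t with Equivalence.to T-∨ t
  ... | inj₁ ta = ∈-++⁺ˡ (∈xs ta)
  ... | inj₂ tb = ∈-++⁺ʳ xs (∈ys tb)

  ind∈params : ∀ φ β {x} → T (occInd x φ) → ind β x ∈ params φ β
  ind∈params (eq y z) β {x} t with Equivalence.to T-∨ t
  ... | inj₁ x≡y = hereₗ (cong (ind β) (≡ᵇ⇒≡ x y x≡y))
  ... | inj₂ x≡z = thereₗ (hereₗ (cong (ind β) (≡ᵇ⇒≡ x z x≡z)))
  ind∈params (pv k p xs) β t = ∈-++⁺ˡ (∈-toList⁺ (∈ᵥ-map⁺ (ind β) (memV⇒∈ᵥ xs t)))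
  ind∈params (neg φ)     β t = ind∈params φ β t
  ind∈params (and φ ψ)   β t = ∈-++-either (params φ β) (params ψ β) (ind∈params φ β) (ind∈params ψ β) t
  ind∈params (or φ ψ)    β t = ∈-++-either (params φ β) (params ψ β) (ind∈params φ β) (ind∈params ψ β) t
  ind∈params (imp φ ψ)   β t = ∈-++-either (params φ β) (params ψ β) (ind∈params φ β) (ind∈params ψ β) t
  ind∈params (iff φ ψ)   β t = ∈-++-either (params φ β) (params ψ β) (ind∈params φ β) (ind∈params ψ β) t
  ind∈params (all y φ)   β {x} t with Equivalence.to T-∨ t
  ... | inj₁ x≡y = hereₗ (cong (ind β) (≡ᵇ⇒≡ x y x≡y))
  ... | inj₂ occ = thereₗ (ind∈params φ β occ)
  ind∈params (ex y φ)    β {x} t with Equivalence.to T-∨ t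
  ... | inj₁ x≡y = hereₗ (cong (ind β) (≡ᵇ⇒≡ x y x≡y))
  ... | inj₂ occ = thereₗ (ind∈params φ β occ)
  ind∈params (allP _ _ φ) β t = ind∈params φ β t
  ind∈params (exP _ _ φ)  β t = ind∈params φ β t

  support⊆params : ∀ φ β {k p e} → e ∈ support (prd β k p) → T (freePred k p φ) → e ∈ params φ β
  support⊆params (eq _ _)      β e∈ ()
  support⊆params (pv k' p' xs) β {k} {p} e∈ t with sameP⇒≡ {k} {p} {k'} {p'} t
  ... | refl , refl = ∈-++⁺ʳ (toList (map (ind β) xs)) e∈
  support⊆params (neg φ)       β e∈ = support⊆params φ β e∈
  support⊆params (and φ ψ)     β {k} {p} e∈ =
    ∈-++-either (params φ β) (params ψ β) (support⊆params φ β {k} {p} e∈) (support⊆params ψ β {k} {p} e∈)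
  support⊆params (or φ ψ)      β {k} {p} e∈ =
    ∈-++-either (params φ β) (params ψ β) (support⊆params φ β {k} {p} e∈) (support⊆params ψ β {k} {p} e∈)
  support⊆params (imp φ ψ)     β {k} {p} e∈ =
    ∈-++-either (params φ β) (params ψ β) (support⊆params φ β {k} {p} e∈) (support⊆params ψ β {k} {p} e∈)
  support⊆params (iff φ ψ)     β {k} {p} e∈ =
    ∈-++-either (params φ β) (params ψ β) (support⊆params φ β {k} {p} e∈) (support⊆params ψ β {k} {p} e∈)
  support⊆params (all _ φ)     β e∈ = thereₗ ∘ support⊆params φ β e∈
  support⊆params (ex _ φ)      β e∈ = thereₗ ∘ support⊆params φ β e∈
  support⊆params (allP _ _ φ)  β e∈ = support⊆params φ β e∈ ∘ proj₂ ∘ Equivalence.to T-∧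
  support⊆params (exP _ _ φ)   β e∈ = support⊆params φ β e∈ ∘ proj₂ ∘ Equivalence.to T-∧

  params-fixed⇒related : ∀ φ β σ → Fixes (_∈ params φ β) σ → RelatedOn (permutationModel-≅ σ) φ β β
  params-fixed⇒related φ β σ fixed = record
    { ind-rel = λ occ → sym (fixed (ind∈params φ β occ))
    ; prd-rel = λ {k} {p} free v → sym (proj₂ (proj₂ (prd β k p)) (↔-sym σ)
                                          (λ e∈ → Fixes-sym σ fixed (support⊆params φ β e∈ free)) v) }

  Sat-moved : ∀ φ β {n} (xs : Vec ℕ n) v σ → Fixes (_∈ params φ β) σ →
              Sat permutationModel φ (updIs β xs v) → Sat permutationModel φ (updIs β xs (map (to σ) v))
  Sat-moved φ β xs v σ fixed =
    transport (permutationModel-≅ σ) φ (Related-updIs xs v (params-fixed⇒related φ β σ fixed))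

  definable-supported : ∀ (em : ExcludedMiddle 0ℓ) {k} G (xs : Vec ℕ (suc k)) β →
                        SupportedBy (Classical.definedBy em G xs β) (_∈ params G β)
  definable-supported em G xs β σ fixed v = holds-cong
    (λ moved → subst (λ v' → Sat permutationModel G (updIs β xs v')) (map-from∘to σ v)
                     (Sat-moved G β xs (map (to σ) v) (↔-sym σ) (Fixes-sym σ fixed) moved))
    (Sat-moved G β xs v σ fixed)
    where open Classical em

permutationModel-HenkinAsser : ExcludedMiddle 0ℓ → HenkinAsser permutationModel
permutationModel-HenkinAsser em =
  Classical.definable⇒HenkinAsser em λ G xs β → params G β , definable-supported em G xs β

<suc-max : ∀ {e K} → e ∈ K → e < suc (max 0 K)
<suc-max {K = K} e∈K = s≤s (Allₗ.lookup (xs≤max 0 K) e∈K)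

¬WO1-permutationModel : Valid permutationModel (neg WO1)
¬WO1-permutationModel β wo with wo (λ _ → true) ([] , λ _ _ _ → refl)
... | Tr , (K , Tr-supp) , _ , _ , antisymmetric , _ , total , _ =
  1+n≢n (sym (antisymmetric a b ((refl , refl) , Tab , Tba)))
  where
  a = suc (max 0 K)
  b = suc a
  outside : Fixes (_∈ K) (transposition a b)
  outside e∈K = swap-other a b (<⇒≢ (<suc-max e∈K)) (<⇒≢ (m<n⇒m<1+n (<suc-max e∈K)))
  Tba≡Tab : Tr (b ∷ a ∷ []) ≡ Tr (a ∷ b ∷ [])
  Tba≡Tab = trans (cong₂ (λ x y → Tr (x ∷ y ∷ [])) (sym (swap-left a b)) (sym (swap-right a b)))
                  (Tr-supp (transposition a b) outside (a ∷ b ∷ []))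
  Tab : Tr (a ∷ b ∷ []) ≡ true
  Tab with total a b (refl , refl)
  ... | inj₁ Tab = Tab
  ... | inj₂ Tba = trans (sym Tba≡Tab) Tba
  Tba : Tr (b ∷ a ∷ []) ≡ true
  Tba = trans Tba≡Tab Tab

extend-injection : ∀ (D : List ℕ) (f : ℕ → ℕ) → (∀ {d d'} → d ∈ D → d' ∈ D → f d ≡ f d' → d ≡ d') →
  Σ Perm λ π → (∀ {d} → d ∈ D → to π d ≡ f d) × Fixes (λ e → e ∉ D × e ∉ mapₗ f D) π
extend-injection []      f _   = ↔-refl , (λ ()) , λ _ → refl
extend-injection (d ∷ D) f inj with extend-injection D f (λ p q → inj (thereₗ p) (thereₗ q)) | d ∈? D
... | π , agrees , fixes | yes d∈D = π , agrees′ , λ (e∉ , e∉f) → fixes (e∉ ∘ thereₗ , e∉f ∘ thereₗ)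
  where
  agrees′ : ∀ {d'} → d' ∈ d ∷ D → to π d' ≡ f d'
  agrees′ (hereₗ refl) = agrees d∈D
  agrees′ (thereₗ p)   = agrees p
... | π , agrees , fixes | no d∉D = ↔-trans π (transposition (to π d) (f d)) , agrees′ , fixes′
  where
  agrees′ : ∀ {d'} → d' ∈ d ∷ D → swap (to π d) (f d) (to π d') ≡ f d'
  agrees′ (hereₗ refl) = swap-left (to π d) (f d)
  agrees′ {d'} (thereₗ d'∈D) = trans (cong (swap (to π d) (f d)) (agrees d'∈D)) (swap-other _ _ f≢πd f≢fd)
    where
    f≢πd : f d' ≢ to π d
    f≢πd e = d∉D (subst (_∈ D) (to-injective π (trans (agrees d'∈D) e)) d'∈D)
    f≢fd : f d' ≢ f d
    f≢fd e = d∉D (subst (_∈ D) (inj (thereₗ d'∈D) (hereₗ refl) e) d'∈D)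
  fixes′ : Fixes (λ e → e ∉ d ∷ D × e ∉ mapₗ f (d ∷ D)) (↔-trans π (transposition (to π d) (f d)))
  fixes′ {e} (e∉ , e∉f) = trans (cong (swap (to π d) (f d)) πe≡e) (swap-other _ _ e≢πd (e∉f ∘ hereₗ))
    where
    πe≡e = fixes (e∉ ∘ thereₗ , e∉f ∘ thereₗ)
    e≢πd : e ≢ to π d
    e≢πd e≡πd = e∉ (hereₗ (to-injective π (trans πe≡e e≡πd)))

Fixes-∉⇒preserves : ∀ π (S : List ℕ) → Fixes (_∉ S) π → ∀ {e} → e ∈ S → to π e ∈ S
Fixes-∉⇒preserves π S fixes {e} e∈S with to π e ∈? S
... | yes πe∈S = πe∈S
... | no πe∉S  = contradiction (subst (_∈ S) (sym (to-injective π (fixes πe∉S))) e∈S) πe∉S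

-- Canonical forms of tuples

firstIndex : ℕ → ∀ {n} → Vec ℕ n → ℕ
firstIndex a []      = 0
firstIndex a (b ∷ u) with a ≟ b
... | yes _ = 0
... | no _  = suc (firstIndex a u)

nth : ∀ {n} → Vec ℕ n → ℕ → ℕ
nth []      _       = 0
nth (b ∷ u) zero    = b
nth (b ∷ u) (suc i) = nth u i

nth-firstIndex : ∀ {a n} (u : Vec ℕ n) → a ∈ᵥ u → nth u (firstIndex a u) ≡ a
nth-firstIndex {a} (b ∷ u) a∈ with a ≟ b | a∈
... | yes a≡b | _          = sym a≡b
... | no a≢b  | here a≡b   = contradiction a≡b a≢b
... | no _    | there a∈u  = nth-firstIndex u a∈u

firstIndex-< : ∀ {a n} (u : Vec ℕ n) → a ∈ᵥ u → firstIndex a u < n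
firstIndex-< {a} (b ∷ u) a∈ with a ≟ b | a∈
... | yes _   | _          = z<s
... | no a≢b  | here a≡b   = contradiction a≡b a≢b
... | no _    | there a∈u  = s<s (firstIndex-< u a∈u)

firstIndex-map : ∀ {h : ℕ → ℕ} → (∀ {x y} → h x ≡ h y → x ≡ y) →
                 ∀ a {n} (u : Vec ℕ n) → firstIndex (h a) (map h u) ≡ firstIndex a u
firstIndex-map     inj a []      = refl
firstIndex-map {h} inj a (b ∷ u) with h a ≟ h b | a ≟ b
... | yes _     | yes _    = refl
... | no _      | no _     = cong suc (firstIndex-map inj a u)
... | yes ha≡hb | no a≢b   = contradiction (inj ha≡hb) a≢b
... | no ha≢hb  | yes refl = contradiction refl ha≢hb

∈-toList-map⁻ : ∀ {f : ℕ → ℕ} {n} (u : Vec ℕ n) {d} → d ∈ toList (map f u) → ∃ λ a → a ∈ᵥ u × d ≡ f a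
∈-toList-map⁻ (a ∷ u) (hereₗ refl) = a , here refl , refl
∈-toList-map⁻ (a ∷ u) (thereₗ p)   = let a' , a'∈u , d≡ = ∈-toList-map⁻ u p in a' , there a'∈u , d≡

module _ (N : ℕ) {n} (u : Vec ℕ n) where

  code : ℕ → ℕ
  code a with a <? N
  ... | yes _ = a
  ... | no _  = N + firstIndex a u

  decode : ℕ → ℕ
  decode c with c <? N
  ... | yes _ = c
  ... | no _  = nth u (c ∸ N)

  code-small : ∀ {a} → a < N → code a ≡ a
  code-small {a} a<N with a <? N
  ... | yes _   = refl
  ... | no a≮N = contradiction a<N a≮N

  code-big : ∀ {a} → ¬ a < N → code a ≡ N + firstIndex a u
  code-big {a} a≮N with a <? N
  ... | yes a<N = contradiction a<N a≮N
  ... | no _    = refl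

  decode-small : ∀ {c} → c < N → decode c ≡ c
  decode-small {c} c<N with c <? N
  ... | yes _   = refl
  ... | no c≮N = contradiction c<N c≮N

  decode-big : ∀ j → decode (N + j) ≡ nth u j
  decode-big j with N + j <? N
  ... | yes N+j<N = contradiction N+j<N (m+n≮m N j)
  ... | no _      = cong (nth u) (m+n∸m≡n N j)

  decode-code : ∀ {a} → a ∈ᵥ u → decode (code a) ≡ a
  decode-code {a} a∈u with a <? N
  ... | yes a<N = decode-small a<N
  ... | no _    = trans (decode-big (firstIndex a u)) (nth-firstIndex u a∈u)

  code-< : ∀ {a} → a ∈ᵥ u → code a < N + n
  code-< {a} a∈u with a <? N
  ... | yes a<N = <-≤-trans a<N (m≤m+n N n)
  ... | no _    = +-monoʳ-< N (firstIndex-< u a∈u)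

  canonical : Vec ℕ n
  canonical = map code u

canonical-below : ∀ N {n} (u : Vec ℕ n) i → lookup (canonical N u) i < N + n
canonical-below N u i = subst (_< _) (sym (lookup-map i (code N u) u)) (code-< N u (∈ᵥ-lookup i u))

canonical-invariant : ∀ N {n} (u : Vec ℕ n) σ → Fixes (_< N) σ → canonical N (map (to σ) u) ≡ canonical N u
canonical-invariant N u σ fixed = trans (sym (map-∘ _ _ u)) (map-cong code-moved u)
  where
  code-moved : ∀ a → code N (map (to σ) u) (to σ a) ≡ code N u a
  code-moved a with a <? N
  ... | yes a<N = trans (cong (code N _) (fixed a<N)) (code-small N _ a<N)
  ... | no a≮N  = trans (code-big N _ σa≮N) (cong (N +_) (firstIndex-map (to-injective σ) a u))
    where
    σa≮N : ¬ to σ a < N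
    σa≮N σa<N = a≮N (subst (_< N) (to-injective σ (fixed σa<N)) σa<N)

record CanonicalPerm (N : ℕ) {n} (u : Vec ℕ n) : Set where
  field
    perm      : Perm
    canonical↦ : map (to perm) (canonical N u) ≡ u
    fixes     : Fixes (_< N) perm
    into-box  : ∀ {M} → N + n ≤ M → ∀ {e} → e < M → to perm e < M ⊎ to perm e ∈ᵥ u

canonicalPerm : ∀ N {n} (u : Vec ℕ n) → CanonicalPerm N u
canonicalPerm N {n} u = record
  { perm = π ; canonical↦ = canonical↦ ; fixes = fixes-below ; into-box = into-box }
  where
  D = toList (canonical N u)
  S = D ++ₗ mapₗ (decode N u) D
  code-decode : ∀ {d} → d ∈ D → code N u (decode N u d) ≡ d
  code-decode d∈D with ∈-toList-map⁻ u d∈D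
  ... | a , a∈u , refl = cong (code N u) (decode-code N u a∈u)
  extension = extend-injection D (decode N u) λ d∈D d'∈D e →
    trans (sym (code-decode d∈D)) (trans (cong (code N u) e) (code-decode d'∈D))
  π = proj₁ extension
  agrees = proj₁ (proj₂ extension)
  fixes-outside : Fixes (_∉ S) π
  fixes-outside e∉S = proj₂ (proj₂ extension) (e∉S ∘ ∈-++⁺ˡ , e∉S ∘ ∈-++⁺ʳ D)

  canonical↦ : map (to π) (canonical N u) ≡ u
  canonical↦ = trans (sym (map-∘ _ _ u)) (trans (map-cong-∈ᵥ u λ a∈u →
    trans (agrees (∈-toList⁺ (∈ᵥ-map⁺ (code N u) a∈u))) (decode-code N u a∈u)) (map-id u))

  fixes-below : Fixes (_< N) π
  fixes-below {e} e<N with e ∈? D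
  ... | yes e∈D = trans (agrees e∈D) (decode-small N u e<N)
  ... | no e∉D  = fixes-outside λ e∈S → [ e∉D , e∉decoded ] (∈-++⁻ D e∈S)
    where
    e∉decoded : e ∉ mapₗ (decode N u) D
    e∉decoded e∈ with ∈-map⁻ (decode N u) e∈
    ... | d , d∈D , refl with ∈-toList-map⁻ u d∈D
    ... | a , a∈u , refl = e∉D (subst (_∈ D) (trans (code-small N u a<N) (sym a≡)) d∈D)
      where
      a≡ = decode-code N u a∈u
      a<N = subst (_< N) a≡ e<N

  into-box : ∀ {M} → N + n ≤ M → ∀ {e} → e < M → to π e < M ⊎ to π e ∈ᵥ u
  into-box {M} N+n≤M {e} e<M with e ∈? S
  ... | no e∉S  = inj₁ (subst (_< M) (sym (fixes-outside e∉S)) e<M)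
  ... | yes e∈S with ∈-++⁻ D (Fixes-∉⇒preserves π S fixes-outside e∈S)
  ...   | inj₁ πe∈D with ∈-toList-map⁻ u πe∈D
  ...     | a , a∈u , πe≡ = inj₁ (subst (_< M) (sym πe≡) (<-≤-trans (code-< N u a∈u) N+n≤M))
  into-box N+n≤M e<M | yes e∈S | inj₂ πe∈decoded with ∈-map⁻ (decode N u) πe∈decoded
  ...     | d , d∈D , πe≡ with ∈-toList-map⁻ u d∈D
  ...       | a , a∈u , refl = inj₂ (subst (_∈ᵥ u) (sym (trans πe≡ (decode-code N u a∈u))) a∈u)

bounded-on-box : ∀ n L (F : Vec ℕ n → ℕ) → ∃ λ M → ∀ c → (∀ i → lookup c i < L) → F c ≤ M
bounded-on-box zero    L F = F [] , λ { [] _ → ≤-refl }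
bounded-on-box (suc n) L F = max 0 (mapₗ bound (upTo L)) , λ { (a ∷ c) below →
  ≤-trans (proj₂ (bounded-on-box n L (F ∘ (a ∷_))) c (below ∘ suc))
          (Allₗ.lookup (xs≤max 0 _) (∈-map⁺ bound (∈-upTo⁺ (below zero)))) }
  where
  bound : ℕ → ℕ
  bound a = proj₁ (bounded-on-box n L (F ∘ (a ∷_)))

-- Choice in the permutation model

map-fixed-∈ : ∀ {n} {h : ℕ → ℕ} {c : Vec ℕ n} → map h c ≡ c → ∀ {e} → e ∈ᵥ c → h e ≡ e
map-fixed-∈ {c = _ ∷ _} hc≡c (here refl) = proj₁ (∷-injective hc≡c)
map-fixed-∈ {c = _ ∷ _} hc≡c (there e∈) = map-fixed-∈ (proj₂ (∷-injective hc≡c)) e∈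

-- Choice for a problem invariant under the permutations fixing [0, N): solve it at the finitely many
-- canonical tuples and carry those solutions along canonical permutations.  This is done twice, because
-- the canonical permutations must also fix the supports of the solutions they carry.
symmetric-choice : ∀ {n m} N (P : Vec ℕ n → (Vec ℕ m → Bool) → Set) →
  (∀ {u R} → P u R → FinitelySupported R) →
  (∀ σ → Fixes (_< N) σ → ∀ {u R} → P u R → P (map (to σ) u) (act σ R)) →
  (∀ {u R R'} → (∀ w → R w ≡ R' w) → P u R → P u R') →
  (∀ u → ∃ (P u)) →
  ∃ λ (S : Vec ℕ (n + m) → Bool) → FinitelySupported S × ∀ u → P u (λ w → S (u ++ w))
symmetric-choice {n} {m} N P supported invariant extensional total =
  S , (upTo M , SupportedBy-mono ∈-upTo⁺ S-supported) , S-solves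
  where
  K₀ : Vec ℕ n → List ℕ
  K₀ c = proj₁ (supported (proj₂ (total c)))
  box = bounded-on-box n (N + n) (λ c → suc (max 0 (K₀ c)))
  M = (N + n) ⊔ proj₁ box
  N+n≤M : N + n ≤ M
  N+n≤M = m≤m⊔n (N + n) _

  local : ∀ u → ∃ λ R → P u R × SupportedBy R (λ e → e < M ⊎ e ∈ᵥ u)
  local u = act π (proj₁ (total c)) ,
            subst (λ u' → P u' (act π (proj₁ (total c)))) canonical↦ (invariant π fixes (proj₂ (total c))) ,
            SupportedBy-mono into-M∪u (SupportedBy-act π (proj₂ (supported (proj₂ (total c)))))
    where
    c = canonical N u
    open CanonicalPerm (canonicalPerm N u) renaming (perm to π)
    into-M∪u : ∀ {e} → from π e ∈ K₀ c → e < M ⊎ e ∈ᵥ u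
    into-M∪u {e} e∈ = subst (λ e' → e' < M ⊎ e' ∈ᵥ u) (strictlyInverseˡ π e) (into-box N+n≤M
      (<-≤-trans (<suc-max e∈) (≤-trans (proj₂ box c (canonical-below N u)) (m≤n⊔m (N + n) _))))

  π : Vec ℕ n → Perm
  π u = CanonicalPerm.perm (canonicalPerm M u)

  R : Vec ℕ n → Vec ℕ m → Bool
  R u = act (π u) (proj₁ (local (canonical M u)))

  S : Vec ℕ (n + m) → Bool
  S z = R (take n z) (drop n z)

  S-solves : ∀ u → P u (λ w → S (u ++ w))
  S-solves u = extensional (λ w → sym (cong₂ R (take-++ u w) (drop-++ u w)))
    (subst (λ u' → P u' (R u)) canonical↦
           (invariant (π u) (fixes ∘ N≤M) (proj₁ (proj₂ (local (canonical M u))))))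
    where
    open CanonicalPerm (canonicalPerm M u)
    N≤M : ∀ {e} → e < N → e < M
    N≤M e<N = <-≤-trans e<N (≤-trans (m≤m+n N n) N+n≤M)

  R-invariant : ∀ σ → Fixes (_< M) σ → ∀ u w → R (map (to σ) u) (map (to σ) w) ≡ R u w
  R-invariant σ fixed u w = begin
    R₁ (canonical M (map (to σ) u)) (map (from π₂) (map (to σ) w))
      ≡⟨ cong (λ c' → R₁ c' (map (from π₂) (map (to σ) w))) (canonical-invariant M u σ fixed) ⟩
    R₁ c (map (from π₂) (map (to σ) w))        ≡⟨ cong (R₁ c) (map-conjugate π₁ σ π₂ w) ⟩
    R₁ c (map (to τ) (map (from π₁) w))        ≡⟨ proj₂ (proj₂ (local c)) τ τ-fixes (map (from π₁) w) ⟩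
    R₁ c (map (from π₁) w)                     ∎
    where
    open ≡-Reasoning
    c = canonical M u
    R₁ = λ c → proj₁ (local c)
    π₁ = π u
    π₂ = π (map (to σ) u)
    τ = conjugate π₁ σ π₂
    module C₁ = CanonicalPerm (canonicalPerm M u)
    module C₂ = CanonicalPerm (canonicalPerm M (map (to σ) u))
    τc≡c : map (to τ) c ≡ c
    τc≡c = begin
      map (to τ) c                                    ≡⟨ cong (map (to τ)) (map-from∘to π₁ c) ⟨
      map (to τ) (map (from π₁) (map (to π₁) c))      ≡⟨ map-conjugate π₁ σ π₂ (map (to π₁) c) ⟨
      map (from π₂) (map (to σ) (map (to π₁) c))      ≡⟨ cong (map (from π₂) ∘ map (to σ)) C₁.canonical↦ ⟩
      map (from π₂) (map (to σ) u)                    ≡⟨ cong (map (from π₂)) C₂.canonical↦ ⟨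
      map (from π₂) (map (to π₂) (canonical M (map (to σ) u))) ≡⟨ map-from∘to π₂ _ ⟩
      canonical M (map (to σ) u)                      ≡⟨ canonical-invariant M u σ fixed ⟩
      c                                               ∎
    τ-fixes : Fixes (λ e → e < M ⊎ e ∈ᵥ c) τ
    τ-fixes (inj₁ e<M) = trans (cong (from π₂ ∘ to σ) (C₁.fixes e<M))
                               (trans (cong (from π₂) (fixed e<M)) (Fixes-sym π₂ C₂.fixes e<M))
    τ-fixes (inj₂ e∈c) = map-fixed-∈ τc≡c e∈c

  S-supported : SupportedBy S (_< M)
  S-supported σ fixed z = trans (cong₂ R (take-map (to σ) n z) (drop-map (to σ) n z))
                                (R-invariant σ fixed (take n z) (drop n z))

permutationModel-EraseClosed : EraseClosed {permutationModel}
permutationModel-EraseClosed {n'} mask S (K , supp) = 0 ∷ K , λ σ fixed z →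
  trans (cong S (moved σ (fixed (hereₗ refl)) z)) (supp σ (fixed ∘ thereₗ) _)
  where
  moved : ∀ σ → to σ 0 ≡ 0 → ∀ z → erase mask (take (suc n') (map (to σ) z)) ++ drop (suc n') (map (to σ) z)
                                 ≡ map (to σ) (erase mask (take (suc n') z) ++ drop (suc n') z)
  moved σ σ0≡0 z = begin
    erase mask (take (suc n') (map (to σ) z)) ++ drop (suc n') (map (to σ) z)
      ≡⟨ cong₂ (λ u w → erase mask u ++ w) (take-map (to σ) (suc n') z) (drop-map (to σ) (suc n') z) ⟩
    erase mask (map (to σ) (take (suc n') z)) ++ map (to σ) (drop (suc n') z)
      ≡⟨ cong (_++ _) (erase-map σ0≡0 mask (take (suc n') z)) ⟩
    map (to σ) (erase mask (take (suc n') z)) ++ map (to σ) (drop (suc n') z)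
      ≡⟨ map-++ (to σ) (erase mask (take (suc n') z)) (drop (suc n') z) ⟨
    map (to σ) (erase mask (take (suc n') z) ++ drop (suc n') z) ∎
    where open ≡-Reasoning

permutationModel-choice : DefinableChoice {permutationModel}
permutationModel-choice {n'} {m'} H β xs d total =
  let S , finite , solves = symmetric-choice N P proj₁ invariant extensional λ u →
                              let (R , j) , h = total u in R , j , h
  in (S , finite) , solves
  where
  open Assignment
  N = suc (max 0 (params H β))
  P : Vec ℕ (suc n') → Pred ℕ m' → Set
  P u R = Σ (FinitelySupported R) λ j →
            Sat permutationModel H (updP permutationModel (updIs β xs u) m' d (R , j))
  invariant : ∀ σ → Fixes (_< N) σ → ∀ {u R} → P u R → P (map (to σ) u) (act σ R)
  invariant σ fixed {u} (j , h) = FinitelySupported-act σ j ,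
    transport (permutationModel-≅ σ) H
      (Related-updP m' d (λ _ → refl) (λ t _ → t)
         (Related-updIs xs u (params-fixed⇒related H β σ (fixed ∘ <suc-max)))) h
  extensional : ∀ {u R R'} → (∀ w → R w ≡ R' w) → P u R → P u R'
  extensional {u} {R} R≗R' ((K , supp) , h) = (K , SupportedBy-≗ R≗R' supp) ,
    transport ≅-refl H (Related-updP m' d (λ w → trans (sym (R≗R' w)) (∼-refl R w)) (λ t _ → t)
                          (Related-refl {Y = λ k p → T (freePred k p H)})) h

permutationModel-choiceh : Model permutationModel choiceh
permutationModel-choiceh = definableChoice⇒choiceh permutationModel-EraseClosed permutationModel-choice

someAssignment : (𝔄 : Structure) → Assignment 𝔄
someAssignment 𝔄 = record { ind = λ _ → inh ; prd = λ k _ → Jne k }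
  where open Structure 𝔄

Model-∪ : ∀ {𝔄 Φ Ψ} → Model 𝔄 Φ → Model 𝔄 Ψ → Model 𝔄 (Φ ∪ Ψ)
Model-∪ ⊨Φ ⊨Ψ φ (inj₁ φ∈Φ) = ⊨Φ φ φ∈Φ
Model-∪ ⊨Φ ⊨Ψ φ (inj₂ φ∈Ψ) = ⊨Ψ φ φ∈Ψ

Model-⟦⟧ : ∀ {𝔄 φ} → Valid 𝔄 φ → Model 𝔄 ⟦ φ ⟧
Model-⟦⟧ ⊨φ _ refl = ⊨φ

countermodel : ∀ {Φ} φ 𝔄 → HenkinAsser 𝔄 → Model 𝔄 Φ → Valid 𝔄 (neg φ) → ¬ Follows Φ φ
countermodel φ 𝔄 ha ⊨Φ ⊨¬φ follows = ⊨¬φ (someAssignment 𝔄) (follows 𝔄 ha ⊨Φ (someAssignment 𝔄))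

theorem5p1 : ExcludedMiddle 0ℓ →
    (Σ Structure λ 𝔄 → HenkinAsser 𝔄 × Model 𝔄 (choiceh ∪ ⟦ WO1 ⟧)) ×
    (Σ Structure λ 𝔄 → HenkinAsser 𝔄 × Model 𝔄 (choiceh ∪ ⟦ neg WO1 ⟧)) ×
    ¬ Follows (hax2 ∪ choiceh) WO1 × ¬ Follows (hax2 ∪ choiceh) (neg WO1)
theorem5p1 em =
  (full ⊤ tt , full-HenkinAsser , Model-∪ full-choiceh (Model-⟦⟧ WO1-full-⊤)) ,
  (permutationModel , permutationModel-HenkinAsser em ,
     Model-∪ permutationModel-choiceh (Model-⟦⟧ ¬WO1-permutationModel)) ,
  countermodel WO1 permutationModel (permutationModel-HenkinAsser em)
    (Model-∪ (permutationModel-HenkinAsser em) permutationModel-choiceh) ¬WO1-permutationModel ,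
  countermodel (neg WO1) (full ⊤ tt) full-HenkinAsser (Model-∪ full-HenkinAsser full-choiceh)
    (λ β ¬WO1 → ¬WO1 (WO1-full-⊤ β))
  where
  full-HenkinAsser : HenkinAsser (full ⊤ tt)
  full-HenkinAsser = Classical.definable⇒HenkinAsser em λ _ _ _ → tt
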